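{- Let $\mathcal{I}=(V,d,k,z)$ be a $2$-metric outlier perturbation resilient instance of $k$-Median with outliers, with unique optimal clustering $\mathcal{C}=\{C_1,\dots,C_k\}$ and outliers $Z$, and let $S=\{c_1,\dots,c_k\}$ be optimal centers inducing $\mathcal{C}$. Let $p\in V\setminus Z$ be assigned to center $c_i$. Then for every other center $c_j\ne c_i$, $2\,d(p,c_i)<d(p,c_j)$.
   Context: An instance $(V,d,k,z)$ of $k$-Median with outliers consists of a finite set $V$, a metric $d$ on $V$, and integers $k,z$. A solution chooses a set $Z$ of at most $z$ outliers, centers $S=\{c_1,\dots,c_k\}\subseteq V\setminus Z$, and the Voronoi partition $\{C_1,\dots,C_k\}$ of $V\setminus Z$ induced by $S$; its cost is $\sum_{i=1}^k\sum_{u\in C_i}d(c_i,u)$. The instance is $2$-metric outlier perturbation resilient if for every metric $d'$ on $V$ with $d(u,v)/2\le d'(u,v)\le d(u,v)$ for all $u,v$, the unique optimal clustering and outliers of $(V,d',k,z)$ are identical to the optimal clustering and outliers of $(V,d,k,z)$.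
   Formalization: The metric $d$ takes rational values instead of real ones, and the perturbations $d'$ in the resilience condition are taken in the rationals as well. -}

module Defs where

open import Data.Nat as ℕ using (ℕ; zero; suc)
open import Data.Fin using (Fin; zero; suc)
open import Data.Fin.Subset using (Subset; _∈_; _∉_; ∣_∣)
open import Data.Fin.Subset.Properties using (_∈?_)
open import Data.Rational using (ℚ; 0ℚ; ½; _+_; _*_; _≤_; _<_)
open import Function.Definitions using (Injective)
open import Relation.Binary.PropositionalEquality using (_≡_; _≢_)
open import Relation.Nullary using (yes; no; ¬_)
open import Data.Product using (_×_)
open import Function.Bundles using (_⇔_)

Dist : ℕ → Set
Dist n = Fin n → Fin n → ℚ

record IsMetric {n : ℕ} (d : Dist n) : Set where
  field
    nonneg   : ∀ u v → 0ℚ ≤ d u v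
    zero⇔eq  : ∀ u v → d u v ≡ 0ℚ ⇔ u ≡ v
    symmetric : ∀ u v → d u v ≡ d v u
    triangle : ∀ u v w → d u w ≤ d u v + d v w

sumFin : ∀ {n} → (Fin n → ℚ) → ℚ
sumFin {zero}  f = 0ℚ
sumFin {suc n} f = f zero + sumFin (λ i → f (suc i))

record Solution {n : ℕ} (d : Dist n) (k z : ℕ) : Set where
  field
    outliers    : Subset n
    fewOutliers : ∣ outliers ∣ ℕ.≤ z
    center      : Fin k → Fin n
    centerInj   : Injective _≡_ _≡_ center
    centerNotOut : ∀ j → center j ∉ outliers
    assign      : Fin n → Fin k
    voronoi     : ∀ p → p ∉ outliers → ∀ j → d p (center (assign p)) ≤ d p (center j)

open Solution public

cost : ∀ {n k z} (d : Dist n) → Solution d k z → ℚ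
cost d s = sumFin λ p → contrib p (p ∈? outliers s)
  where
  contrib : ∀ p → _ → ℚ
  contrib p (yes _) = 0ℚ
  contrib p (no _)  = d (center s (assign s p)) p

Optimal : ∀ {n k z} (d : Dist n) → Solution d k z → Set
Optimal {k = k} {z = z} d s = ∀ (t : Solution d k z) → cost d s ≤ cost d t

SameClusteringAndOutliers : ∀ {n k z} {d d' : Dist n} →
  Solution d k z → Solution d' k z → Set
SameClusteringAndOutliers {n} s t =
  (∀ p → (p ∈ outliers s) ⇔ (p ∈ outliers t)) ×
  (∀ (p q : Fin n) → p ∉ outliers s → q ∉ outliers s →
     (assign s p ≡ assign s q) ⇔ (assign t p ≡ assign t q))

-- 2-metric outlier perturbation resilience: for every metric d' with
-- d/2 ≤ d' ≤ d, every optimal solution of (V,d',k,z) has the same clustering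
-- and outliers as every optimal solution of (V,d,k,z).  (Taking d' = d this
-- includes uniqueness of the optimal clustering/outliers of d; uniqueness
-- for d' follows as well.)
PerturbationResilient2 : ∀ {n} (d : Dist n) (k z : ℕ) → Set
PerturbationResilient2 {n} d k z =
  ∀ (d' : Dist n) → IsMetric d' →
  (∀ u v → (½ * d u v ≤ d' u v) × (d' u v ≤ d u v)) →
  ∀ (s : Solution d' k z) (t : Solution d k z) →
  Optimal d' s → Optimal d t → SameClusteringAndOutliers s t

{-# OPTIONS --safe #-}
-- Suppose d(p, c_j) ≤ 2 d(p, c_i) for some j ≠ i. Adding to d an edge of length
-- d(p, c_i) between p and c_j gives a metric d′ with d/2 ≤ d′ ≤ d, in which sending p
-- to c_j and keeping everything else is a Voronoi solution of cost at most OPT(d).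
-- By resilience every d′-optimal solution has the clustering of s, and inside the
-- clusters of s the new edge shortens nothing, so it costs at least OPT(d). Hence the
-- moved solution is d′-optimal, and resilience applied to it keeps p with c_i: j = i.
module Submission where

open import Defs
open import Data.Nat using (ℕ)
open import Data.Fin using (Fin)
open import Data.Fin.Subset using (_∉_)
open import Data.Rational using (ℚ; _+_; _<_)
open import Relation.Binary.PropositionalEquality using (_≢_)

import Data.Nat as ℕ
open import Data.Nat using (zero; suc)
open import Data.Fin using (zero; suc)
open import Data.Bool using (true; false)
open import Data.Empty using (⊥-elim)
open import Data.Fin.Properties using (_≟_; all?)
open import Data.Fin.Subset using (Subset; _∈_; ∣_∣; inside; outside)
open import Data.Fin.Subset.Properties using (_∈?_)
open import Data.List using (List; []; _∷_; [_]; allFin; cartesianProduct; cartesianProductWith; mapMaybe)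
open import Data.List.Membership.Propositional using (lose) renaming (_∈_ to _∈ₗ_)
open import Data.List.Membership.Propositional.Properties
  using (∈-allFin; ∈-cartesianProduct⁺; ∈-cartesianProductWith⁺)
open import Data.List.Relation.Unary.Any using (here; there)
import Data.List.Relation.Unary.Any.Properties as Any
open import Data.Maybe using (Maybe; just; nothing)
import Data.Maybe.Relation.Unary.Any as Maybe
open import Data.Product using (∃; _×_; _,_; proj₁; proj₂)
open import Data.Rational using (0ℚ; ½; _*_; _≤_; _⊓_)
open import Data.Rational.Properties
  using ( ≤-refl; ≤-reflexive; ≤-trans; ≤-antisym; _≤?_; ≰⇒>; ≤-decTotalOrder
        ; +-assoc; +-identityʳ; +-mono-≤; +-monoˡ-≤; +-monoʳ-≤; *-monoˡ-≤-nonNeg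
        ; ⊓-sel; ⊓-glb; p⊓q≤p; p⊓q≤q; module ≤-Reasoning)
open import Data.Rational.Solver using (module +-*-Solver)
open import Data.Sum using (inj₁; inj₂)
open import Data.Vec using (Vec; []; _∷_; lookup; tabulate)
open import Data.Vec.Properties using (lookup∘tabulate)
open import Function.Bundles using (Equivalence; mk⇔)
open import Function.Definitions using (Injective)
open import Relation.Binary.Bundles using (DecTotalOrder)
open import Relation.Binary.PropositionalEquality using (_≡_; refl; sym; trans; cong; cong₂; subst)
open import Relation.Nullary using (Dec; yes; no; ¬?; _×-dec_; _→-dec_)
open import Data.List.Extrema (DecTotalOrder.totalOrder ≤-decTotalOrder) using (argmin; f[argmin]≤v⁺)

open +-*-Solver using (solve; _:+_; _:*_; _:=_; con)
open ≤-Reasoning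

x≤x+y : ∀ x {y} → 0ℚ ≤ y → x ≤ x + y
x≤x+y x {y} 0≤y = subst (_≤ x + y) (+-identityʳ x) (+-monoʳ-≤ x 0≤y)

half-≤ : ∀ {x y} → x ≤ y + y → ½ * x ≤ y
half-≤ {x} {y} x≤2y = begin
  ½ * x        ≤⟨ *-monoˡ-≤-nonNeg ½ x≤2y ⟩
  ½ * (y + y)  ≡⟨ solve 1 (λ y → con ½ :* (y :+ y) := y) refl y ⟩
  y            ∎

module _ {n} {e : Dist n} (e-metric : IsMetric e) where
  open IsMetric e-metric

  dist-self : ∀ u → e u u ≡ 0ℚ
  dist-self u = Equivalence.from (zero⇔eq u u) refl

  dist≤0⇒≡ : ∀ {u v} → e u v ≤ 0ℚ → u ≡ v
  dist≤0⇒≡ {u} {v} e≤0 = Equivalence.to (zero⇔eq u v) (≤-antisym e≤0 (nonneg u v))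

  assign-center : ∀ {k z} (S : Solution e k z) j → assign S (center S j) ≡ j
  assign-center S j = sym (centerInj S (dist≤0⇒≡ (begin
    e c (center S (assign S c))  ≤⟨ voronoi S c (centerNotOut S j) j ⟩
    e c c                        ≡⟨ dist-self c ⟩
    0ℚ                           ∎)))
    where
    c : Fin n
    c = center S j

-- A shortest route in d plus one extra edge between x and y uses that edge at most once,
-- in one of two directions; the shortest-path metric `shortcut` minimises over these.
data Route : Set where
  direct forth back : Route

_∙_ : Route → Route → Route
direct ∙ r      = r
forth  ∙ direct = forth
forth  ∙ forth  = forth
forth  ∙ back   = direct
back   ∙ direct = back
back   ∙ forth  = direct
back   ∙ back   = back

reverse : Route → Route
reverse direct = direct
reverse forth  = back
reverse back   = forth

module Shortcut {n} {d : Dist n} (d-metric : IsMetric d) (x y : Fin n) (ℓ : ℚ) (0≤ℓ : 0ℚ ≤ ℓ) where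
  open IsMetric d-metric

  via : Fin n → Fin n → Dist n
  via a b u v = (d u a + ℓ) + d b v

  via-nonneg : ∀ a b u v → 0ℚ ≤ via a b u v
  via-nonneg a b u v = +-mono-≤ (+-mono-≤ (nonneg u a) 0≤ℓ) (nonneg b v)

  via-reverse : ∀ a b u v → via b a v u ≡ via a b u v
  via-reverse a b u v = begin-equality
    (d v b + ℓ) + d a u  ≡⟨ cong₂ (λ p q → (p + ℓ) + q) (symmetric v b) (symmetric a u) ⟩
    (d b v + ℓ) + d u a  ≡⟨ regroup (d b v) ℓ (d u a) ⟩
    (d u a + ℓ) + d b v  ∎
    where
    regroup : ∀ p l q → (p + l) + q ≡ (q + l) + p
    regroup = solve 3 (λ p l q → (p :+ l) :+ q := (q :+ l) :+ p) refl

  via-pre : ∀ a b u v w → via a b u w ≤ d u v + via a b v w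
  via-pre a b u v w = begin
    (d u a + ℓ) + d b w            ≤⟨ +-monoˡ-≤ (d b w) (+-monoˡ-≤ ℓ (triangle u v a)) ⟩
    ((d u v + d v a) + ℓ) + d b w  ≡⟨ regroup (d u v) (d v a) ℓ (d b w) ⟩
    d u v + ((d v a + ℓ) + d b w)  ∎
    where
    regroup : ∀ p q l r → ((p + q) + l) + r ≡ p + ((q + l) + r)
    regroup = solve 4 (λ p q l r → ((p :+ q) :+ l) :+ r := p :+ ((q :+ l) :+ r)) refl

  via-post : ∀ a b u v w → via a b u w ≤ via a b u v + d v w
  via-post a b u v w = begin
    (d u a + ℓ) + d b w            ≤⟨ +-monoʳ-≤ (d u a + ℓ) (triangle b v w) ⟩
    (d u a + ℓ) + (d b v + d v w)  ≡⟨ +-assoc (d u a + ℓ) (d b v) (d v w) ⟨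
    ((d u a + ℓ) + d b v) + d v w  ∎

  via-via : ∀ a b u v w → via a b u w ≤ via a b u v + via a b v w
  via-via a b u v w = begin
    (d u a + ℓ) + d b w                            ≤⟨ x≤x+y _ loop≥0 ⟩
    ((d u a + ℓ) + d b w) + (d b v + (d v a + ℓ))  ≡⟨ regroup (d u a) ℓ (d b w) (d b v) (d v a) ⟩
    ((d u a + ℓ) + d b v) + ((d v a + ℓ) + d b w)  ∎
    where
    loop≥0 : 0ℚ ≤ d b v + (d v a + ℓ)
    loop≥0 = +-mono-≤ (nonneg b v) (+-mono-≤ (nonneg v a) 0≤ℓ)
    regroup : ∀ p l q r s → ((p + l) + q) + (r + (s + l)) ≡ ((p + l) + r) + ((s + l) + q)
    regroup = solve 5 (λ p l q r s → ((p :+ l) :+ q) :+ (r :+ (s :+ l))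
                                  := ((p :+ l) :+ r) :+ ((s :+ l) :+ q)) refl

  via-back : ∀ a b u v w → d u w ≤ via a b u v + via b a v w
  via-back a b u v w = begin
    d u w                                          ≤⟨ triangle u a w ⟩
    d u a + d a w                                  ≤⟨ x≤x+y _ loop≥0 ⟩
    (d u a + d a w) + ((ℓ + d b v) + (d v b + ℓ))  ≡⟨ regroup (d u a) (d a w) ℓ (d b v) (d v b) ⟩
    ((d u a + ℓ) + d b v) + ((d v b + ℓ) + d a w)  ∎
    where
    loop≥0 : 0ℚ ≤ (ℓ + d b v) + (d v b + ℓ)
    loop≥0 = +-mono-≤ (+-mono-≤ 0≤ℓ (nonneg b v)) (+-mono-≤ (nonneg v b) 0≤ℓ)
    regroup : ∀ p q l r s → (p + q) + ((l + r) + (s + l)) ≡ ((p + l) + r) + ((s + l) + q)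
    regroup = solve 5 (λ p q l r s → (p :+ q) :+ ((l :+ r) :+ (s :+ l))
                                  := ((p :+ l) :+ r) :+ ((s :+ l) :+ q)) refl

  ≤-via-doubled : ∀ a b u v → d a b ≤ ℓ + ℓ → d u v ≤ via a b u v + via a b u v
  ≤-via-doubled a b u v dab≤2ℓ = begin
    d u v                                          ≤⟨ triangle u a v ⟩
    d u a + d a v                                  ≤⟨ +-monoʳ-≤ (d u a) (triangle a b v) ⟩
    d u a + (d a b + d b v)                        ≤⟨ +-monoʳ-≤ (d u a) (+-monoˡ-≤ (d b v) dab≤2ℓ) ⟩
    d u a + ((ℓ + ℓ) + d b v)                      ≤⟨ x≤x+y _ (+-mono-≤ (nonneg u a) (nonneg b v)) ⟩
    (d u a + ((ℓ + ℓ) + d b v)) + (d u a + d b v)  ≡⟨ regroup (d u a) ℓ (d b v) ⟩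
    via a b u v + via a b u v                      ∎
    where
    regroup : ∀ p l q → (p + ((l + l) + q)) + (p + q) ≡ ((p + l) + q) + ((p + l) + q)
    regroup = solve 3 (λ p l q → (p :+ ((l :+ l) :+ q)) :+ (p :+ q)
                              := ((p :+ l) :+ q) :+ ((p :+ l) :+ q)) refl

  length : Route → Dist n
  length direct = d
  length forth  = via x y
  length back   = via y x

  length-nonneg : ∀ r u v → 0ℚ ≤ length r u v
  length-nonneg direct = nonneg
  length-nonneg forth  = via-nonneg x y
  length-nonneg back   = via-nonneg y x

  length-∙ : ∀ r r′ u v w → length (r ∙ r′) u w ≤ length r u v + length r′ v w
  length-∙ direct direct = triangle
  length-∙ direct forth  = via-pre x y
  length-∙ direct back   = via-pre y x
  length-∙ forth  direct = via-post x y
  length-∙ forth  forth  = via-via x y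
  length-∙ forth  back   = via-back x y
  length-∙ back   direct = via-post y x
  length-∙ back   forth  = via-back y x
  length-∙ back   back   = via-via y x

  length-reverse : ∀ r u v → length (reverse r) v u ≡ length r u v
  length-reverse direct u v = symmetric v u
  length-reverse forth      = via-reverse x y
  length-reverse back       = via-reverse y x

  shortcut : Dist n
  shortcut u v = d u v ⊓ (via x y u v ⊓ via y x u v)

  shortcut-≤ : ∀ r u v → shortcut u v ≤ length r u v
  shortcut-≤ direct u v = p⊓q≤p _ _
  shortcut-≤ forth  u v = ≤-trans (p⊓q≤q (d u v) _) (p⊓q≤p (via x y u v) (via y x u v))
  shortcut-≤ back   u v = ≤-trans (p⊓q≤q (d u v) _) (p⊓q≤q (via x y u v) (via y x u v))

  ≤-shortcut : ∀ {q} u v → (∀ r → q ≤ length r u v) → q ≤ shortcut u v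
  ≤-shortcut u v q≤ = ⊓-glb (q≤ direct) (⊓-glb (q≤ forth) (q≤ back))

  shortcut-attained : ∀ u v → ∃ λ r → shortcut u v ≡ length r u v
  shortcut-attained u v
    with ⊓-sel (d u v) (via x y u v ⊓ via y x u v) | ⊓-sel (via x y u v) (via y x u v)
  ... | inj₁ eq | _        = direct , eq
  ... | inj₂ eq | inj₁ eq′ = forth , trans eq eq′
  ... | inj₂ eq | inj₂ eq′ = back , trans eq eq′

  shortcut-triangle : ∀ u v w → shortcut u w ≤ shortcut u v + shortcut v w
  shortcut-triangle u v w with shortcut-attained u v | shortcut-attained v w
  ... | r , eq | r′ , eq′ = begin
    shortcut u w                  ≤⟨ shortcut-≤ (r ∙ r′) u w ⟩
    length (r ∙ r′) u w           ≤⟨ length-∙ r r′ u v w ⟩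
    length r u v + length r′ v w  ≡⟨ cong₂ _+_ eq eq′ ⟨
    shortcut u v + shortcut v w   ∎

  shortcut-sym-≤ : ∀ u v → shortcut v u ≤ shortcut u v
  shortcut-sym-≤ u v with shortcut-attained u v
  ... | r , eq = begin
    shortcut v u            ≤⟨ shortcut-≤ (reverse r) v u ⟩
    length (reverse r) v u  ≡⟨ length-reverse r u v ⟩
    length r u v            ≡⟨ eq ⟨
    shortcut u v            ∎

  shortcut-sym : ∀ u v → shortcut u v ≡ shortcut v u
  shortcut-sym u v = ≤-antisym (shortcut-sym-≤ v u) (shortcut-sym-≤ u v)

  shortcut-≤-ℓ : shortcut x y ≤ ℓ
  shortcut-≤-ℓ = begin
    shortcut x y         ≤⟨ shortcut-≤ forth x y ⟩
    (d x x + ℓ) + d y y  ≡⟨ cong₂ (λ p q → (p + ℓ) + q) (dist-self d-metric x) (dist-self d-metric y) ⟩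
    (0ℚ + ℓ) + 0ℚ        ≡⟨ solve 1 (λ l → (con 0ℚ :+ l) :+ con 0ℚ := l) refl ℓ ⟩
    ℓ                    ∎

  module _ (close : d x y ≤ ℓ + ℓ) where

    ≤-shortcut-doubled : ∀ u v → d u v ≤ shortcut u v + shortcut u v
    ≤-shortcut-doubled u v with shortcut-attained u v
    ... | r , eq = subst (λ q → d u v ≤ q + q) (sym eq) (≤-length-doubled r)
      where
      ≤-length-doubled : ∀ r → d u v ≤ length r u v + length r u v
      ≤-length-doubled direct = x≤x+y (d u v) (nonneg u v)
      ≤-length-doubled forth  = ≤-via-doubled x y u v close
      ≤-length-doubled back   = ≤-via-doubled y x u v (subst (_≤ ℓ + ℓ) (symmetric x y) close)

    shortcut-isMetric : IsMetric shortcut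
    shortcut-isMetric = record
      { nonneg    = λ u v → ≤-shortcut u v λ r → length-nonneg r u v
      ; zero⇔eq   = λ u v → mk⇔ (shortcut≡0⇒≡ u v) λ { refl → shortcut-self u }
      ; symmetric = shortcut-sym
      ; triangle  = shortcut-triangle
      }
      where
      shortcut≡0⇒≡ : ∀ u v → shortcut u v ≡ 0ℚ → u ≡ v
      shortcut≡0⇒≡ u v eq = dist≤0⇒≡ d-metric
        (subst (λ q → d u v ≤ q + q) eq (≤-shortcut-doubled u v))
      shortcut-self : ∀ u → shortcut u u ≡ 0ℚ
      shortcut-self u = ≤-antisym
        (≤-trans (shortcut-≤ direct u u) (≤-reflexive (dist-self d-metric u)))
        (≤-shortcut u u λ r → length-nonneg r u u)

sumFin-mono : ∀ {n} {f g : Fin n → ℚ} → (∀ i → f i ≤ g i) → sumFin f ≤ sumFin g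
sumFin-mono {zero}  f≤g = ≤-refl
sumFin-mono {suc n} f≤g = +-mono-≤ (f≤g zero) (sumFin-mono (λ i → f≤g (suc i)))

-- `cost` sums a function local to its definition; unification against `refl` names it.
summand : ∀ {n} {f : Fin n → ℚ} {q : ℚ} → q ≡ sumFin f → Fin n → ℚ
summand {f = f} _ = f

pointCost : ∀ {n k z} (d : Dist n) → Solution d k z → Fin n → ℚ
pointCost d s = summand {q = cost d s} refl

cost-mono : ∀ {n k z} {d d′ : Dist n} (s : Solution d k z) (t : Solution d′ k z) →
  outliers s ≡ outliers t →
  (∀ u → u ∉ outliers s → d (center s (assign s u)) u ≤ d′ (center t (assign t u)) u) →
  cost d s ≤ cost d′ t
cost-mono {d = d} {d′} s t same-outliers ≤-inlier = sumFin-mono pointwise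
  where
  pointwise : ∀ u → pointCost d s u ≤ pointCost d′ t u
  pointwise u with u ∈? outliers s | u ∈? outliers t
  ... | yes _  | yes _  = ≤-refl
  ... | no u∉  | no _   = ≤-inlier u u∉
  ... | yes u∈ | no u∉  = ⊥-elim (u∉ (subst (u ∈_) same-outliers u∈))
  ... | no u∉  | yes u∈ = ⊥-elim (u∉ (subst (u ∈_) (sym same-outliers) u∈))

voronoi-cost-≤ : ∀ {n k z} {e e′ : Dist n} → (∀ u v → e u v ≡ e v u) →
  (S : Solution e k z) (T : Solution e′ k z) →
  outliers S ≡ outliers T → (∀ j → center S j ≡ center T j) →
  (∀ u → u ∉ outliers T → e (center T (assign T u)) u ≤ e′ (center T (assign T u)) u) →
  cost e S ≤ cost e′ T
voronoi-cost-≤ {e = e} {e′} e-sym S T same-outliers same-centers ≤-inlier =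
  cost-mono S T same-outliers λ u u∉ → begin
    e (center S (assign S u)) u   ≡⟨ e-sym _ u ⟩
    e u (center S (assign S u))   ≤⟨ voronoi S u u∉ (assign T u) ⟩
    e u (center S (assign T u))   ≡⟨ cong (e u) (same-centers (assign T u)) ⟩
    e u (center T (assign T u))   ≡⟨ e-sym u _ ⟩
    e (center T (assign T u)) u   ≤⟨ ≤-inlier u (subst (u ∉_) same-outliers u∉) ⟩
    e′ (center T (assign T u)) u  ∎

module _ {n k} (e : Dist n) (c : Fin k → Fin n) where

  nearestCenter : Fin k → Fin n → Fin k
  nearestCenter j₀ u = argmin (λ j → e u (c j)) j₀ (allFin k)

  nearestCenter-≤ : ∀ j₀ u j → e u (c (nearestCenter j₀ u)) ≤ e u (c j)
  nearestCenter-≤ j₀ u j = f[argmin]≤v⁺ j₀ (allFin k) (inj₂ (lose (∈-allFin j) ≤-refl))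

-- The given assignment only seeds the search for a nearest center, since Fin k may be empty.
nearestSolution : ∀ {n k z} (e : Dist n) (O : Subset n) → ∣ O ∣ ℕ.≤ z →
  (c : Fin k → Fin n) → Injective _≡_ _≡_ c → (∀ j → c j ∉ O) → (Fin n → Fin k) →
  Solution e k z
nearestSolution e O few c c-inj c∉O seed = record
  { outliers     = O
  ; fewOutliers  = few
  ; center       = c
  ; centerInj    = c-inj
  ; centerNotOut = c∉O
  ; assign       = λ u → nearestCenter e c (seed u) u
  ; voronoi      = λ u _ → nearestCenter-≤ e c (seed u) u
  }

reassign : ∀ {n k z} {e′ : Dist n} (e : Dist n) → Solution e′ k z → Solution e k z
reassign e t =
  nearestSolution e (outliers t) (fewOutliers t) (center t) (centerInj t) (centerNotOut t) (assign t)

vectors : {A : Set} → List A → (k : ℕ) → List (Vec A k)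
vectors xs zero    = [ [] ]
vectors xs (suc k) = cartesianProductWith _∷_ xs (vectors xs k)

∈-vectors : {A : Set} {xs : List A} → (∀ a → a ∈ₗ xs) →
  ∀ {k} (v : Vec A k) → v ∈ₗ vectors xs k
∈-vectors all∈ []      = here refl
∈-vectors all∈ (a ∷ v) = ∈-cartesianProductWith⁺ _∷_ (all∈ a) (∈-vectors all∈ v)

subsets : (n : ℕ) → List (Subset n)
subsets = vectors (inside ∷ outside ∷ [])

∈-subsets : ∀ {n} (O : Subset n) → O ∈ₗ subsets n
∈-subsets = ∈-vectors λ { true → here refl ; false → there (here refl) }

-- Resilience only speaks about optimal solutions, so one must exist: it is found
-- among the Voronoi solutions of the finitely many choices of outliers and centers.
module _ {n k z} {e : Dist n} (e-sym : ∀ u v → e u v ≡ e v u) (s₀ : Solution e k z) where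

  Layout : Set
  Layout = Subset n × Vec (Fin n) k

  layouts : List Layout
  layouts = cartesianProduct (subsets n) (vectors (allFin n) k)

  Feasible : Layout → Set
  Feasible (O , v) =
    ∣ O ∣ ℕ.≤ z × (∀ i j → lookup v i ≡ lookup v j → i ≡ j) × (∀ j → lookup v j ∉ O)

  feasible? : ∀ x → Dec (Feasible x)
  feasible? (O , v) = (∣ O ∣ ℕ.≤? z)
    ×-dec all? (λ i → all? λ j → (lookup v i ≟ lookup v j) →-dec (i ≟ j))
    ×-dec all? (λ j → ¬? (lookup v j ∈? O))

  candidate : Layout → Maybe (Solution e k z)
  candidate (O , v) with feasible? (O , v)
  ... | yes (few , v-inj , v∉O) = just (nearestSolution e O few (lookup v) (v-inj _ _) v∉O (assign s₀))
  ... | no _                    = nothing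

  layoutOf : Solution e k z → Layout
  layoutOf T = outliers T , tabulate (center T)

  layoutOf-feasible : ∀ T → Feasible (layoutOf T)
  layoutOf-feasible T = fewOutliers T , v-inj , v∉O
    where
    v-inj : ∀ i j → lookup (tabulate (center T)) i ≡ lookup (tabulate (center T)) j → i ≡ j
    v-inj i j eq = centerInj T
      (trans (sym (lookup∘tabulate (center T) i)) (trans eq (lookup∘tabulate (center T) j)))
    v∉O : ∀ j → lookup (tabulate (center T)) j ∉ outliers T
    v∉O j = subst (_∉ outliers T) (sym (lookup∘tabulate (center T) j)) (centerNotOut T j)

  candidate-≤ : ∀ T → Maybe.Any (λ S → cost e S ≤ cost e T) (candidate (layoutOf T))
  candidate-≤ T with feasible? (layoutOf T)
  ... | yes (_ , _ , _) =
    Maybe.just (voronoi-cost-≤ e-sym _ T refl (lookup∘tabulate (center T)) λ _ _ → ≤-refl)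
  ... | no infeasible   = ⊥-elim (infeasible (layoutOf-feasible T))

  optimal-exists : ∃ (Optimal e)
  optimal-exists = argmin (cost e) s₀ solutions , λ T →
    f[argmin]≤v⁺ s₀ solutions (inj₂ (Any.mapMaybe⁺ candidate layouts
      (Any.map⁺ (lose (layoutOf∈layouts T) (candidate-≤ T)))))
    where
    layoutOf∈layouts : ∀ T → layoutOf T ∈ₗ layouts
    layoutOf∈layouts T = ∈-cartesianProduct⁺ (∈-subsets (outliers T)) (∈-vectors ∈-allFin _)
    solutions : List (Solution e k z)
    solutions = mapMaybe candidate layouts

module CloseCenter {n k z} {d : Dist n} (d-metric : IsMetric d) (s : Solution d k z)
  (p : Fin n) (p∉ : p ∉ outliers s) (j : Fin k)
  (close : d p (center s j) ≤ d p (center s (assign s p)) + d p (center s (assign s p))) where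
  open IsMetric d-metric

  private
    O : Subset n
    O = outliers s
    c : Fin k → Fin n
    c = center s
    σ : Fin n → Fin k
    σ = assign s
    i : Fin k
    i = σ p

  radius : Fin n → ℚ
  radius u = d u (c (σ u))

  open Shortcut d-metric p (c j) (radius p) (nonneg p (c i))

  radius-≤-through-p : ∀ {u} → u ∉ O → radius u ≤ d u p + radius p
  radius-≤-through-p {u} u∉ = ≤-trans (voronoi s u u∉ i) (triangle u p (c i))

  radii-≤-detour : ∀ r → r ≢ direct → ∀ {u v} → u ∉ O → v ∉ O →
    radius u + radius v ≤ length r u v
  radii-≤-detour direct r≢direct = ⊥-elim (r≢direct refl)
  radii-≤-detour forth _ {u} {v} u∉ v∉ = begin
    radius u + radius v             ≤⟨ +-mono-≤ (radius-≤-through-p u∉) (voronoi s v v∉ j) ⟩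
    (d u p + radius p) + d v (c j)  ≡⟨ cong ((d u p + radius p) +_) (symmetric v (c j)) ⟩
    (d u p + radius p) + d (c j) v  ∎
  radii-≤-detour back _ {u} {v} u∉ v∉ = begin
    radius u + radius v             ≤⟨ +-mono-≤ (voronoi s u u∉ j) (radius-≤-through-p v∉) ⟩
    d u (c j) + (d v p + radius p)  ≡⟨ cong (λ q → d u (c j) + (q + radius p)) (symmetric v p) ⟩
    d u (c j) + (d p v + radius p)  ≡⟨ regroup (d u (c j)) (d p v) (radius p) ⟩
    (d u (c j) + radius p) + d p v  ∎
    where
    regroup : ∀ q w l → q + (w + l) ≡ (q + l) + w
    regroup = solve 3 (λ q w l → q :+ (w :+ l) := (q :+ l) :+ w) refl

  radius-≤-shortcut : ∀ {u} → u ∉ O → ∀ m → radius u ≤ shortcut u (c m)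
  radius-≤-shortcut {u} u∉ m = ≤-shortcut u (c m) λ where
      direct → voronoi s u u∉ m
      forth  → ≤-trans radius≤radii (radii-≤-detour forth (λ ()) u∉ (centerNotOut s m))
      back   → ≤-trans radius≤radii (radii-≤-detour back (λ ()) u∉ (centerNotOut s m))
    where
    radius≤radii : radius u ≤ radius u + radius (c m)
    radius≤radii = x≤x+y (radius u) (nonneg _ _)

  shortcut-within-cluster : ∀ {u v} → u ∉ O → v ∉ O → σ u ≡ σ v → d u v ≤ shortcut u v
  shortcut-within-cluster {u} {v} u∉ v∉ same = ≤-shortcut u v λ where
      direct → ≤-refl
      forth  → ≤-trans through-center (radii-≤-detour forth (λ ()) u∉ v∉)
      back   → ≤-trans through-center (radii-≤-detour back (λ ()) u∉ v∉)
    where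
    through-center : d u v ≤ radius u + radius v
    through-center = begin
      d u v                        ≤⟨ triangle u (c (σ u)) v ⟩
      radius u + d (c (σ u)) v     ≡⟨ cong (λ m → radius u + d (c m) v) same ⟩
      radius u + d (c (σ v)) v     ≡⟨ cong (radius u +_) (symmetric (c (σ v)) v) ⟩
      radius u + radius v          ∎

  moved : Fin n → Fin k
  moved u with u ≟ p
  ... | yes _ = j
  ... | no _  = σ u

  moved-voronoi : ∀ u → u ∉ O → ∀ m → shortcut u (c (moved u)) ≤ shortcut u (c m)
  moved-voronoi u u∉ m with u ≟ p
  ... | yes refl = ≤-trans shortcut-≤-ℓ (radius-≤-shortcut p∉ m)
  ... | no _     = ≤-trans (shortcut-≤ direct u (c (σ u))) (radius-≤-shortcut u∉ m)

  relocated : Solution shortcut k z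
  relocated = record
    { outliers     = O
    ; fewOutliers  = fewOutliers s
    ; center       = c
    ; centerInj    = centerInj s
    ; centerNotOut = centerNotOut s
    ; assign       = moved
    ; voronoi      = moved-voronoi
    }

  moved-≤ : ∀ u → shortcut (c (moved u)) u ≤ d (c (σ u)) u
  moved-≤ u with u ≟ p
  ... | yes refl = begin
    shortcut (c j) p  ≡⟨ shortcut-sym (c j) p ⟩
    shortcut p (c j)  ≤⟨ shortcut-≤-ℓ ⟩
    d p (c i)         ≡⟨ symmetric p (c i) ⟩
    d (c i) p         ∎
  ... | no _     = shortcut-≤ direct (c (σ u)) u

  moved-p : moved p ≡ j
  moved-p with p ≟ p
  ... | yes _  = refl
  ... | no p≢p = ⊥-elim (p≢p refl)

  moved-other : ∀ {u} → u ≢ p → moved u ≡ σ u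
  moved-other {u} u≢p with u ≟ p
  ... | yes u≡p = ⊥-elim (u≢p u≡p)
  ... | no _    = refl

  module _ (resilient : PerturbationResilient2 d k z) (s-opt : Optimal d s) where

    shortcut-metric : IsMetric shortcut
    shortcut-metric = shortcut-isMetric close

    shortcut-between : ∀ u v → (½ * d u v ≤ shortcut u v) × (shortcut u v ≤ d u v)
    shortcut-between u v = half-≤ (≤-shortcut-doubled close u v) , shortcut-≤ direct u v

    -- An optimal clustering for the shortcut is that of s, within whose clusters the
    -- shortcut does not shrink distances; so reassigning it under d costs no more.
    optimal-cost-≥ : ∀ t → Optimal shortcut t → cost d s ≤ cost shortcut t
    optimal-cost-≥ t t-opt = ≤-trans (s-opt (reassign d t))
      (voronoi-cost-≤ symmetric (reassign d t) t refl (λ _ → refl) center-≤)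
      where
      same : SameClusteringAndOutliers t s
      same = resilient shortcut shortcut-metric shortcut-between t s t-opt s-opt
      in-s : ∀ {u} → u ∉ outliers t → u ∉ O
      in-s u∉ u∈ = u∉ (Equivalence.from (proj₁ same _) u∈)
      center-≤ : ∀ u → u ∉ outliers t →
        d (center t (assign t u)) u ≤ shortcut (center t (assign t u)) u
      center-≤ u u∉ = shortcut-within-cluster (in-s v∉) (in-s u∉)
          (Equivalence.to (proj₂ same v u v∉ u∉) (assign-center shortcut-metric t (assign t u)))
        where
        v : Fin n
        v = center t (assign t u)
        v∉ : v ∉ outliers t
        v∉ = centerNotOut t (assign t u)

    relocated-optimal : Optimal shortcut relocated
    relocated-optimal t with optimal-exists shortcut-sym relocated
    ... | t* , t*-opt = begin
      cost shortcut relocated  ≤⟨ cost-mono relocated s refl (λ u _ → moved-≤ u) ⟩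
      cost d s                 ≤⟨ optimal-cost-≥ t* t*-opt ⟩
      cost shortcut t*         ≤⟨ t*-opt t ⟩
      cost shortcut t          ∎

    is-own-center : j ≡ i
    is-own-center with c i ≟ p
    ... | yes ci≡p = centerInj s (sym (trans ci≡p (dist≤0⇒≡ d-metric p≈cj)))
      where
      p≈cj : d p (c j) ≤ 0ℚ
      p≈cj = subst (λ q → d p (c j) ≤ q + q) (trans (cong (d p) ci≡p) (dist-self d-metric p)) close
    ... | no ci≢p  =
      trans (sym moved-p) (trans same-cluster (trans (moved-other ci≢p) (assign-center d-metric s i)))
      where
      same : SameClusteringAndOutliers relocated s
      same = resilient shortcut shortcut-metric shortcut-between relocated s relocated-optimal s-opt
      same-cluster : moved p ≡ moved (c i)
      same-cluster = Equivalence.from (proj₂ same p (c i) p∉ (centerNotOut s i))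
        (sym (assign-center d-metric s i))

mainTheorem8 : (n k z : ℕ) (d : Dist n) → IsMetric d →
    PerturbationResilient2 d k z →
    (s : Solution d k z) → Optimal d s →
    (p : Fin n) → p ∉ outliers s →
    (j : Fin k) → j ≢ assign s p →
    d p (center s (assign s p)) + d p (center s (assign s p)) < d p (center s j)
mainTheorem8 n k z d d-metric resilient s s-opt p p∉ j j≢i
  with d p (center s j) ≤? d p (center s (assign s p)) + d p (center s (assign s p))
... | yes close = ⊥-elim (j≢i (CloseCenter.is-own-center d-metric s p p∉ j close resilient s-opt))
... | no far    = ≰⇒> far
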